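{- For all integers $i,j$, $e_i(\mathbf{u})e_j(\mathbf{u})=e_j(\mathbf{u})e_i(\mathbf{u})$ holds in the algebra $\mathcal{U}/I_{\mathrm{KR}}^{\mathrm{st}}$.
   Context: $\mathcal{U}=\mathbb{Z}\langle u_1,\dots,u_N\rangle$; the letter $a$ denotes $u_a$, so monomials are words in $\{1,\dots,N\}$. $I_{\mathrm{KR}}^{\mathrm{st}}$ is the two-sided ideal generated by $b(ac-ca)-(ac-ca)b$ for letters $a<b<c$ and by all words with a repeated letter. $e_d(\mathbf{u})=\sum_{N\ge i_1>\cdots>i_d\ge1}u_{i_1}\cdots u_{i_d}$ for $d>0$, $e_0(\mathbf{u})=1$, $e_d(\mathbf{u})=0$ for $d<0$. -}

module Defs where

open import Data.Nat using (ℕ; zero; suc)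
open import Data.Integer using (ℤ; +_; -[1+_]; _+_; -_; _*_)
open import Data.Fin using (Fin; _<_; _>_)
open import Data.Fin.Properties using (_<?_) renaming (_≟_ to _≟ᶠ_)
open import Data.List using (List; []; _∷_; _++_; map; concatMap; allFin; filter)
open import Data.List.Properties using (≡-dec)
open import Data.List.Relation.Unary.Linked using (Linked; linked?)

open import Data.List.Relation.Unary.Unique.Propositional using (Unique)
open import Data.Product using (_×_; _,_)
open import Relation.Nullary using (¬_; yes; no; Dec)
open import Relation.Binary.PropositionalEquality using (_≡_)
open import Relation.Binary.Definitions using (Decidable)

module _ (N : ℕ) where

  -- Letters are u_1,…,u_N, encoded as Fin N (letter a ↦ a-1); order is preserved.
  Letter : Set
  Letter = Fin N

  Word : Set
  Word = List Letter

  -- Elements of 𝒰 = ℤ⟨u_1,…,u_N⟩ represented as formal ℤ-linear combinations of words.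
  Poly : Set
  Poly = List (ℤ × Word)

  _≟w_ : Decidable {A = Word} _≡_
  _≟w_ = ≡-dec _≟ᶠ_

  coeff : Poly → Word → ℤ
  coeff [] w = + 0
  coeff ((c , v) ∷ p) w with v ≟w w
  ... | yes _ = c + coeff p w
  ... | no  _ = coeff p w

  _≈_ : Poly → Poly → Set
  p ≈ q = ∀ w → coeff p w ≡ coeff q w

  mono : Word → Poly
  mono w = (+ 1 , w) ∷ []

  1ᵤ : Poly
  1ᵤ = mono []

  0ᵤ : Poly
  0ᵤ = []

  _⊕_ : Poly → Poly → Poly
  p ⊕ q = p ++ q

  scale : ℤ → Poly → Poly
  scale c = map (λ { (d , w) → (c * d , w) })

  ⊖_ : Poly → Poly
  ⊖ p = scale (-[1+ 0 ]) p

  _⊝_ : Poly → Poly → Poly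
  p ⊝ q = p ⊕ (⊖ q)

  _⊗_ : Poly → Poly → Poly
  p ⊗ q = concatMap (λ { (c , v) → map (λ { (d , w) → (c * d , v ++ w) }) q }) p

  var : Letter → Poly
  var a = mono (a ∷ [])

  commGen : Letter → Letter → Letter → Poly
  commGen a b c = (var b ⊗ ((var a ⊗ var c) ⊝ (var c ⊗ var a)))
                ⊝ (((var a ⊗ var c) ⊝ (var c ⊗ var a)) ⊗ var b)

  data IsGen : Poly → Set where
    comm : ∀ {a b c} → a < b → b < c → IsGen (commGen a b c)
    rep  : ∀ {w} → ¬ Unique w → IsGen (mono w)

  data InIdeal : Poly → Set where
    nil    : InIdeal 0ᵤ
    addGen : ∀ {g p} → IsGen g → (c : ℤ) (l r : Word) → InIdeal p →
             InIdeal (scale c (mono l ⊗ (g ⊗ mono r)) ⊕ p)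
    resp   : ∀ {p q} → p ≈ q → InIdeal p → InIdeal q

  _≡ᴵ_ : Poly → Poly → Set
  p ≡ᴵ q = InIdeal (p ⊝ q)

  words : ℕ → List Word
  words zero    = [] ∷ []
  words (suc d) = concatMap (λ a → map (a ∷_) (words d)) (allFin N)

  Decr : Word → Set
  Decr = Linked _>_

  decr? : (w : Word) → Dec (Decr w)
  decr? = linked? (λ x y → y <? x)

  e : ℤ → Poly
  e (+ zero)  = 1ᵤ
  e (+ suc d) = map (λ w → (+ 1 , w)) (filter decr? (words (suc d)))
  e -[1+ _ ]  = 0ᵤ

-- Write E d S for e_d in the letters of a strictly decreasing alphabet S and induct on S.
-- If n is the largest letter of S = n ∷ S′, then E (d+1) S = u_n E d S′ + E (d+1) S′, and
-- expanding [E (i+1) S, E (j+1) S] leaves, besides terms killed by the repeated letter u_n or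
-- by induction, the terms [u_n, E (k+1) S′] E l S′. A letter x with a < x < n commutes with
-- [u_n, u_a] modulo I (this is the relation b(ac − ca) = (ac − ca)b), which gives
-- [u_n, E (k+1) S′] ≡ Σ [u_n, u_a] E k (P ++ Q) over all ways of writing S′ = P ++ a ∷ Q.
-- Finally E l S′ and E l (P ++ Q) differ by words containing a, which vanish after [u_n, u_a],
-- so what is left is Σ [u_n, u_a] [E j (P ++ Q), E i (P ++ Q)], zero by induction on the
-- smaller alphabet P ++ Q.

module Submission where

open import Defs
open import Data.Nat as ℕ using (ℕ; zero; suc)
import Data.Nat.Properties as ℕ
open import Data.Integer as ℤ using (ℤ; +_; -[1+_]; _+_; _*_; _-_)
open import Data.Integer.Properties using (*-assoc; *-distribˡ-+; +-assoc; +-identityˡ; +-identityʳ; *-identityˡ; *-identityʳ; *-zeroˡ; *-zeroʳ; *-distribʳ-+)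
open import Data.Integer.Tactic.RingSolver using (solve-∀)
import Data.List as List
open import Data.List using (List; []; _∷_; _++_; map; length; deduplicate; tabulate; concatMap; cartesianProductWith; allFin; filter)
open import Data.List.Properties using (++-assoc; ++-identityʳ; map-++; ∷-injective)
open import Data.List.Membership.Propositional using (_∈_; _∉_; lose)
open import Data.List.Membership.DecPropositional using (_∈?_)
open import Data.List.Membership.Propositional.Properties using (∈-deduplicate⁺; ∈-deduplicate⁻; ∈-map⁻; ∈-map⁺; ∈-++⁻; ∈-tabulate⁺; ∈-allFin; ∈-filter⁺; ∈-filter⁻; ∈-concatMap⁺; ∈-concatMap⁻; ∈-++⁺ˡ; ∈-++⁺ʳ)
open import Data.List.Relation.Unary.All using (All; []; _∷_)
import Data.List.Relation.Unary.All as All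
import Data.List.Relation.Unary.All.Properties as All
open import Data.List.Relation.Unary.Any using (here; there; satisfied)
open import Data.List.Relation.Unary.Unique.Propositional using (Unique)
import Data.List.Relation.Unary.Unique.Propositional.Properties as Unique
open import Data.List.Relation.Unary.Linked.Properties using (Linked⇒AllPairs; AllPairs⇒Linked)
open import Data.List.Relation.Unary.AllPairs using (AllPairs; []; _∷_)
import Data.List.Relation.Unary.AllPairs.Properties as AllPairs
import Data.List.Relation.Unary.Unique.DecPropositional.Properties as DecUnique
open import Data.List.Relation.Binary.Subset.Propositional using (_⊆_)
open import Data.Product using (Σ-syntax; _×_; _,_; proj₂; uncurry)
open import Data.Sum using (inj₁; inj₂)
open import Data.Fin using (Fin; _<_; _>_; opposite)
import Data.Fin.Properties as Fin
open import Data.Vec as Vec using (Vec; []; _∷_)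
open import Data.Vec.N-ary using (N-ary; _$ⁿ_)
open import Function using (_∘_; flip)
open import Data.Empty using (⊥; ⊥-elim)
open import Relation.Nullary using (¬_; Dec; yes; no; contradiction)
open import Relation.Nullary.Decidable using (True; toWitness)
open import Relation.Binary.PropositionalEquality hiding (resp)
open ≡-Reasoning

private
  *-assoc-+ : ∀ c d x y → c * d * x + c * y ≡ c * (d * x + y)
  *-assoc-+ = solve-∀

module Pairing (N : ℕ) where

  infixl 6 _⊞_ _⊟_
  infixl 7 _⊠_
  infix 4 _∼_

  _⊞_ _⊟_ _⊠_ : Poly N → Poly N → Poly N
  _⊞_ = _⊕_ N
  _⊟_ = _⊝_ N
  _⊠_ = _⊗_ N

  -- p and q are equal in 𝒰 iff their pairings with all functionals on words agree (∼⇒≈, ≈⇒∼).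
  eval : Poly N → (Word N → ℤ) → ℤ
  eval []            g = + 0
  eval ((c , w) ∷ p) g = c * g w + eval p g

  record _∼_ (p q : Poly N) : Set where
    constructor mk∼
    field eval-≡ : ∀ g → eval p g ≡ eval q g
  open _∼_ public

  eval-⊞ : ∀ p q g → eval (p ⊞ q) g ≡ eval p g + eval q g
  eval-⊞ []            q g = sym (+-identityˡ _)
  eval-⊞ ((c , w) ∷ p) q g =
    trans (cong (_+_ (c * g w)) (eval-⊞ p q g)) (sym (+-assoc (c * g w) _ _))

  eval-scale : ∀ c p g → eval (scale N c p) g ≡ c * eval p g
  eval-scale c []            g = sym (*-zeroʳ c)
  eval-scale c ((d , w) ∷ p) g =
    trans (cong (_+_ (c * d * g w)) (eval-scale c p g)) (*-assoc-+ c d (g w) (eval p g))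

  eval-⊟ : ∀ p q g → eval (p ⊟ q) g ≡ eval p g - eval q g
  eval-⊟ p q g = begin
    eval (p ⊞ scale N -[1+ 0 ] q) g         ≡⟨ eval-⊞ p (scale N -[1+ 0 ] q) g ⟩
    eval p g + eval (scale N -[1+ 0 ] q) g  ≡⟨ cong (_+_ (eval p g)) (eval-scale -[1+ 0 ] q g) ⟩
    eval p g + -[1+ 0 ] * eval q g          ≡⟨ minus (eval p g) (eval q g) ⟩
    eval p g - eval q g                     ∎
    where
    minus : ∀ x y → x + -[1+ 0 ] * y ≡ x - y
    minus = solve-∀

  eval-cong : ∀ p {g h} → (∀ w → g w ≡ h w) → eval p g ≡ eval p h
  eval-cong []            g≗h = refl
  eval-cong ((c , w) ∷ p) g≗h = cong₂ (λ x y → c * x + y) (g≗h w) (eval-cong p g≗h)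

  eval-zero : ∀ p → eval p (λ _ → + 0) ≡ + 0
  eval-zero []            = refl
  eval-zero ((c , w) ∷ p) = cong₂ _+_ (*-zeroʳ c) (eval-zero p)

  eval-+ : ∀ p g h → eval p (λ w → g w + h w) ≡ eval p g + eval p h
  eval-+ []            g h = refl
  eval-+ ((c , w) ∷ p) g h =
    trans (cong (_+_ (c * (g w + h w))) (eval-+ p g h)) (interchange c (g w) (h w) (eval p g) (eval p h))
    where
    interchange : ∀ c a b x y → c * (a + b) + (x + y) ≡ (c * a + x) + (c * b + y)
    interchange = solve-∀

  eval-*ˡ : ∀ p d g → eval p (λ w → d * g w) ≡ d * eval p g
  eval-*ˡ []            d g = sym (*-zeroʳ d)
  eval-*ˡ ((c , w) ∷ p) d g =
    trans (cong (_+_ (c * (d * g w))) (eval-*ˡ p d g)) (pull d c (g w) (eval p g))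
    where
    pull : ∀ d c a x → c * (d * a) + d * x ≡ d * (c * a + x)
    pull = solve-∀

  eval-⊠ : ∀ p q g → eval (p ⊠ q) g ≡ eval p (λ v → eval q (λ u → g (v ++ u)))
  eval-⊠ []            q g = refl
  eval-⊠ ((c , v) ∷ p) q g = begin
    eval (row q ++ p ⊠ q) g         ≡⟨ eval-⊞ (row q) (p ⊠ q) g ⟩
    eval (row q) g + eval (p ⊠ q) g ≡⟨ cong₂ _+_ (eval-row q) (eval-⊠ p q g) ⟩
    c * eval q (λ u → g (v ++ u)) + eval p (λ v → eval q (λ u → g (v ++ u))) ∎
    where
    row : Poly N → Poly N
    row = map (λ { (d , w) → (c * d , v ++ w) })
    eval-row : ∀ q → eval (row q) g ≡ c * eval q (λ u → g (v ++ u))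
    eval-row [] = sym (*-zeroʳ c)
    eval-row ((d , w) ∷ q) =
      trans (cong (_+_ (c * d * g (v ++ w))) (eval-row q)) (*-assoc-+ c d (g (v ++ w)) _)

  eval-mono : ∀ w g → eval (mono N w) g ≡ g w
  eval-mono w g = trans (+-identityʳ _) (*-identityˡ _)

  eval-mono-⊠ : ∀ w p g → eval (mono N w ⊠ p) g ≡ eval p (λ u → g (w ++ u))
  eval-mono-⊠ w p g = trans (eval-⊠ (mono N w) p g) (eval-mono w (λ v → eval p (λ u → g (v ++ u))))

  eval-⊠-mono : ∀ p w g → eval (p ⊠ mono N w) g ≡ eval p (λ u → g (u ++ w))
  eval-⊠-mono p w g = trans (eval-⊠ p (mono N w) g) (eval-cong p (λ u → eval-mono w (λ v → g (u ++ v))))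

  ∼-refl : ∀ {p} → p ∼ p
  ∼-refl = mk∼ λ g → refl

  ∼-sym : ∀ {p q} → p ∼ q → q ∼ p
  ∼-sym p∼q = mk∼ λ g → sym (eval-≡ p∼q g)

  ∼-trans : ∀ {p q r} → p ∼ q → q ∼ r → p ∼ r
  ∼-trans p∼q q∼r = mk∼ λ g → trans (eval-≡ p∼q g) (eval-≡ q∼r g)

  ≡⇒∼ : ∀ {p q} → p ≡ q → p ∼ q
  ≡⇒∼ refl = ∼-refl

  ⊞-cong : ∀ {p p′ q q′} → p ∼ p′ → q ∼ q′ → p ⊞ q ∼ p′ ⊞ q′
  ⊞-cong {p} {p′} {q} {q′} p∼p′ q∼q′ = mk∼ λ g → begin
    eval (p ⊞ q) g          ≡⟨ eval-⊞ p q g ⟩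
    eval p g + eval q g     ≡⟨ cong₂ _+_ (eval-≡ p∼p′ g) (eval-≡ q∼q′ g) ⟩
    eval p′ g + eval q′ g   ≡⟨ eval-⊞ p′ q′ g ⟨
    eval (p′ ⊞ q′) g        ∎

  ⊟-cong : ∀ {p p′ q q′} → p ∼ p′ → q ∼ q′ → p ⊟ q ∼ p′ ⊟ q′
  ⊟-cong {p} {p′} {q} {q′} p∼p′ q∼q′ = mk∼ λ g → begin
    eval (p ⊟ q) g          ≡⟨ eval-⊟ p q g ⟩
    eval p g - eval q g     ≡⟨ cong₂ _-_ (eval-≡ p∼p′ g) (eval-≡ q∼q′ g) ⟩
    eval p′ g - eval q′ g   ≡⟨ eval-⊟ p′ q′ g ⟨
    eval (p′ ⊟ q′) g        ∎

  ⊠-cong : ∀ {p p′ q q′} → p ∼ p′ → q ∼ q′ → p ⊠ q ∼ p′ ⊠ q′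
  ⊠-cong {p} {p′} {q} {q′} p∼p′ q∼q′ = mk∼ λ g → begin
    eval (p ⊠ q) g                                ≡⟨ eval-⊠ p q g ⟩
    eval p (λ v → eval q (λ u → g (v ++ u)))      ≡⟨ eval-cong p (λ v → eval-≡ q∼q′ _) ⟩
    eval p (λ v → eval q′ (λ u → g (v ++ u)))     ≡⟨ eval-≡ p∼p′ _ ⟩
    eval p′ (λ v → eval q′ (λ u → g (v ++ u)))    ≡⟨ eval-⊠ p′ q′ g ⟨
    eval (p′ ⊠ q′) g                              ∎

  δ : Word N → Word N → ℤ
  δ v w with _≟w_ N v w
  ... | yes _ = + 1
  ... | no  _ = + 0

  δ-refl : ∀ w → δ w w ≡ + 1
  δ-refl w with _≟w_ N w w
  ... | yes _   = refl
  ... | no  w≢w = ⊥-elim (w≢w refl)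

  δ-≢ : ∀ {v w} → v ≢ w → δ v w ≡ + 0
  δ-≢ {v} {w} v≢w with _≟w_ N v w
  ... | yes v≡w = ⊥-elim (v≢w v≡w)
  ... | no  _   = refl

  coeff-∷ : ∀ c v p w → coeff N ((c , v) ∷ p) w ≡ c * δ v w + coeff N p w
  coeff-∷ c v p w with _≟w_ N v w
  ... | yes _ = cong (_+ coeff N p w) (sym (*-identityʳ c))
  ... | no  _ = sym (trans (cong (_+ coeff N p w) (*-zeroʳ c)) (+-identityˡ _))

  coeff-eval : ∀ p w → coeff N p w ≡ eval p (λ v → δ v w)
  coeff-eval []            w = refl
  coeff-eval ((c , v) ∷ p) w = trans (coeff-∷ c v p w) (cong (_+_ (c * δ v w)) (coeff-eval p w))

  ∼⇒≈ : ∀ {p q} → p ∼ q → _≈_ N p q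
  ∼⇒≈ {p} {q} p∼q w = trans (coeff-eval p w) (trans (eval-≡ p∼q _) (sym (coeff-eval q w)))

  sumOn : List (Word N) → (Word N → ℤ) → ℤ
  sumOn []       f = + 0
  sumOn (w ∷ ws) f = f w + sumOn ws f

  sumOn-cong : ∀ ws {f g} → (∀ {w} → w ∈ ws → f w ≡ g w) → sumOn ws f ≡ sumOn ws g
  sumOn-cong []       f≗g = refl
  sumOn-cong (w ∷ ws) f≗g = cong₂ _+_ (f≗g (here refl)) (sumOn-cong ws (f≗g ∘ there))

  sumOn-zero : ∀ ws {f} → (∀ {w} → w ∈ ws → f w ≡ + 0) → sumOn ws f ≡ + 0
  sumOn-zero []       f≗0 = refl
  sumOn-zero (w ∷ ws) f≗0 = cong₂ _+_ (f≗0 (here refl)) (sumOn-zero ws (f≗0 ∘ there))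

  sumOn-+ : ∀ ws f g → sumOn ws (λ w → f w + g w) ≡ sumOn ws f + sumOn ws g
  sumOn-+ []       f g = refl
  sumOn-+ (w ∷ ws) f g =
    trans (cong (_+_ (f w + g w)) (sumOn-+ ws f g)) (interchange (f w) (g w) (sumOn ws f) (sumOn ws g))
    where
    interchange : ∀ a b x y → (a + b) + (x + y) ≡ (a + x) + (b + y)
    interchange = solve-∀

  sumOn-*ˡ : ∀ ws c f → sumOn ws (λ w → c * f w) ≡ c * sumOn ws f
  sumOn-*ˡ []       c f = sym (*-zeroʳ c)
  sumOn-*ˡ (w ∷ ws) c f =
    trans (cong (_+_ (c * f w)) (sumOn-*ˡ ws c f)) (sym (*-distribˡ-+ c (f w) (sumOn ws f)))

  sumOn-δ : ∀ {ws v} (f : Word N → ℤ) → Unique ws → v ∈ ws → sumOn ws (λ w → δ v w * f w) ≡ f v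
  sumOn-δ {w ∷ ws} f (w∉ws ∷ _) (here refl) = begin
    δ w w * f w + sumOn ws (λ u → δ w u * f u) ≡⟨ cong₂ _+_ (cong (_* f w) (δ-refl w)) (sumOn-zero ws vanish) ⟩
    + 1 * f w + + 0                             ≡⟨ +-identityʳ _ ⟩
    + 1 * f w                                   ≡⟨ *-identityˡ (f w) ⟩
    f w                                         ∎
    where
    vanish : ∀ {u} → u ∈ ws → δ w u * f u ≡ + 0
    vanish {u} u∈ws = trans (cong (_* f u) (δ-≢ (All.lookup w∉ws u∈ws))) (*-zeroˡ (f u))
  sumOn-δ {w ∷ ws} {v} f (w∉ws ∷ ws!) (there v∈ws) = begin
    δ v w * f w + sumOn ws (λ u → δ v u * f u)  ≡⟨ cong (_+ sumOn ws (λ u → δ v u * f u)) δvw*fw≡0 ⟩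
    + 0 + sumOn ws (λ u → δ v u * f u)          ≡⟨ +-identityˡ _ ⟩
    sumOn ws (λ u → δ v u * f u)                ≡⟨ sumOn-δ f ws! v∈ws ⟩
    f v                                         ∎
    where
    δvw*fw≡0 : δ v w * f w ≡ + 0
    δvw*fw≡0 = trans (cong (_* f w) (δ-≢ (λ v≡w → All.lookup w∉ws v∈ws (sym v≡w)))) (*-zeroˡ (f w))

  support : Poly N → List (Word N)
  support = map proj₂

  eval-as-sum : ∀ ws p f → Unique ws → support p ⊆ ws → eval p f ≡ sumOn ws (λ w → coeff N p w * f w)
  eval-as-sum ws []            f ws! _   = sym (sumOn-zero ws (λ {w} _ → *-zeroˡ (f w)))
  eval-as-sum ws ((c , v) ∷ p) f ws! sub = sym (begin
    sumOn ws (λ w → coeff N ((c , v) ∷ p) w * f w)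
      ≡⟨ sumOn-cong ws (λ {w} _ → trans (cong (_* f w) (coeff-∷ c v p w)) (*-distribʳ-+ (f w) (c * δ v w) (coeff N p w))) ⟩
    sumOn ws (λ w → c * δ v w * f w + coeff N p w * f w)
      ≡⟨ sumOn-+ ws (λ w → c * δ v w * f w) (λ w → coeff N p w * f w) ⟩
    sumOn ws (λ w → c * δ v w * f w) + sumOn ws (λ w → coeff N p w * f w)
      ≡⟨ cong₂ _+_ (trans (sumOn-cong ws (λ {w} _ → *-assoc c (δ v w) (f w))) (sumOn-*ˡ ws c (λ w → δ v w * f w)))
                   (sym (eval-as-sum ws p f ws! (sub ∘ there))) ⟩
    c * sumOn ws (λ w → δ v w * f w) + eval p f
      ≡⟨ cong (λ x → c * x + eval p f) (sumOn-δ f ws! (sub (here refl))) ⟩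
    c * f v + eval p f ∎)

  CoeffsAgree : Poly N → Poly N → Set
  CoeffsAgree p q = All (λ w → coeff N p w ≡ coeff N q w) (support p ++ support q)

  -- Both pairings are sums over the same duplicate-free list of words.
  coeffsAgree⇒∼ : ∀ {p q} → CoeffsAgree p q → p ∼ q
  coeffsAgree⇒∼ {p} {q} agree = mk∼ λ f → begin
    eval p f                              ≡⟨ eval-as-sum ws p f ws! (∈-deduplicate⁺ (_≟w_ N) ∘ ∈-++⁺ˡ) ⟩
    sumOn ws (λ w → coeff N p w * f w)    ≡⟨ sumOn-cong ws (λ {w} w∈ws → cong (_* f w) (agree-at w∈ws)) ⟩
    sumOn ws (λ w → coeff N q w * f w)    ≡⟨ eval-as-sum ws q f ws! (∈-deduplicate⁺ (_≟w_ N) ∘ ∈-++⁺ʳ (support p)) ⟨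
    eval q f                              ∎
    where
    ws : List (Word N)
    ws = deduplicate (_≟w_ N) (support p ++ support q)
    ws! : Unique ws
    ws! = DecUnique.deduplicate-! (_≟w_ N) (support p ++ support q)
    agree-at : ∀ {w} → w ∈ ws → coeff N p w ≡ coeff N q w
    agree-at = All.lookup agree ∘ ∈-deduplicate⁻ (_≟w_ N) (support p ++ support q)

  ≈⇒∼ : ∀ {p q} → _≈_ N p q → p ∼ q
  ≈⇒∼ p≈q = coeffsAgree⇒∼ (All.tabulate (λ {w} _ → p≈q w))

  coeffsAgree? : ∀ p q → Dec (CoeffsAgree p q)
  coeffsAgree? p q = All.all? (λ w → coeff N p w ℤ.≟ coeff N q w) (support p ++ support q)

module Solver where

  infixl 6 _:+_ _:-_
  infixl 7 _:*_

  data Expr (k : ℕ) : Set where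
    atom            : Fin k → Expr k
    _:+_ _:-_ _:*_  : Expr k → Expr k → Expr k
    :0 :1           : Expr k

  :[_,_] : ∀ {k} → Expr k → Expr k → Expr k
  :[ a , b ] = a :* b :- b :* a

  normalise : ∀ {k} → Expr k → Poly k
  normalise {k} (atom i) = var k i
  normalise {k} (a :+ b) = _⊕_ k (normalise a) (normalise b)
  normalise {k} (a :- b) = _⊝_ k (normalise a) (normalise b)
  normalise {k} (a :* b) = _⊗_ k (normalise a) (normalise b)
  normalise {k} :0       = 0ᵤ k
  normalise {k} :1       = 1ᵤ k

  module _ {N k : ℕ} (ρ : Vec (Poly N) k) where
    open Pairing N
    private module Free = Pairing k

    ⟪_⟫ : Expr k → Poly N
    ⟪ atom i ⟫ = Vec.lookup ρ i
    ⟪ a :+ b ⟫ = ⟪ a ⟫ ⊞ ⟪ b ⟫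
    ⟪ a :- b ⟫ = ⟪ a ⟫ ⊟ ⟪ b ⟫
    ⟪ a :* b ⟫ = ⟪ a ⟫ ⊠ ⟪ b ⟫
    ⟪ :0 ⟫     = 0ᵤ N
    ⟪ :1 ⟫     = 1ᵤ N

    substitute : Word k → Poly N
    substitute []      = 1ᵤ N
    substitute (i ∷ m) = Vec.lookup ρ i ⊠ substitute m

    eval-substitute-++ : ∀ m m′ g → eval (substitute (m ++ m′)) g
                         ≡ eval (substitute m) (λ v → eval (substitute m′) (λ u → g (v ++ u)))
    eval-substitute-++ []      m′ g = sym (eval-mono [] (λ v → eval (substitute m′) (λ u → g (v ++ u))))
    eval-substitute-++ (i ∷ m) m′ g = begin
      eval (x ⊠ substitute (m ++ m′)) g
        ≡⟨ eval-⊠ x (substitute (m ++ m′)) g ⟩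
      eval x (λ v → eval (substitute (m ++ m′)) (λ u → g (v ++ u)))
        ≡⟨ eval-cong x (λ v → trans (eval-substitute-++ m m′ (λ u → g (v ++ u)))
             (eval-cong (substitute m) (λ v′ → eval-cong (substitute m′) (λ u → cong g (sym (++-assoc v v′ u)))))) ⟩
      eval x (λ v → eval (substitute m) (λ v′ → eval (substitute m′) (λ u → g ((v ++ v′) ++ u))))
        ≡⟨ eval-⊠ x (substitute m) _ ⟨
      eval (x ⊠ substitute m) (λ v → eval (substitute m′) (λ u → g (v ++ u))) ∎
      where
      x : Poly N
      x = Vec.lookup ρ i

    eval-swap : ∀ p q (h : Word N → Word k → ℤ) →
                eval p (λ v → Free.eval q (h v)) ≡ Free.eval q (λ m → eval p (λ v → h v m))
    eval-swap p []            h = eval-zero p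
    eval-swap p ((c , m) ∷ q) h = begin
      eval p (λ v → c * h v m + Free.eval q (h v))
        ≡⟨ eval-+ p (λ v → c * h v m) (λ v → Free.eval q (h v)) ⟩
      eval p (λ v → c * h v m) + eval p (λ v → Free.eval q (h v))
        ≡⟨ cong₂ _+_ (eval-*ˡ p c (λ v → h v m)) (eval-swap p q h) ⟩
      c * eval p (λ v → h v m) + Free.eval q (λ m′ → eval p (λ v → h v m′)) ∎

    eval-⟪⟫ : ∀ e g → eval ⟪ e ⟫ g ≡ Free.eval (normalise e) (λ m → eval (substitute m) g)
    eval-⟪⟫ (atom i) g = sym (begin
      Free.eval (var k i) (λ m → eval (substitute m) g)   ≡⟨ Free.eval-mono (i ∷ []) (λ m → eval (substitute m) g) ⟩
      eval (x ⊠ 1ᵤ N) g                                   ≡⟨ eval-⊠-mono x [] g ⟩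
      eval x (λ u → g (u ++ []))                          ≡⟨ eval-cong x (λ u → cong g (++-identityʳ u)) ⟩
      eval x g                                            ∎)
      where
      x : Poly N
      x = Vec.lookup ρ i
    eval-⟪⟫ (a :+ b) g = begin
      eval (⟪ a ⟫ ⊞ ⟪ b ⟫) g                                      ≡⟨ eval-⊞ ⟪ a ⟫ ⟪ b ⟫ g ⟩
      eval ⟪ a ⟫ g + eval ⟪ b ⟫ g                                 ≡⟨ cong₂ _+_ (eval-⟪⟫ a g) (eval-⟪⟫ b g) ⟩
      Free.eval (normalise a) σ + Free.eval (normalise b) σ       ≡⟨ Free.eval-⊞ (normalise a) (normalise b) σ ⟨
      Free.eval (normalise (a :+ b)) σ                            ∎
      where
      σ : Word k → ℤ
      σ m = eval (substitute m) g
    eval-⟪⟫ (a :- b) g = begin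
      eval (⟪ a ⟫ ⊟ ⟪ b ⟫) g                                      ≡⟨ eval-⊟ ⟪ a ⟫ ⟪ b ⟫ g ⟩
      eval ⟪ a ⟫ g - eval ⟪ b ⟫ g                                 ≡⟨ cong₂ _-_ (eval-⟪⟫ a g) (eval-⟪⟫ b g) ⟩
      Free.eval (normalise a) σ - Free.eval (normalise b) σ       ≡⟨ Free.eval-⊟ (normalise a) (normalise b) σ ⟨
      Free.eval (normalise (a :- b)) σ                            ∎
      where
      σ : Word k → ℤ
      σ m = eval (substitute m) g
    eval-⟪⟫ (a :* b) g = begin
      eval (⟪ a ⟫ ⊠ ⟪ b ⟫) g
        ≡⟨ eval-⊠ ⟪ a ⟫ ⟪ b ⟫ g ⟩
      eval ⟪ a ⟫ (λ v → eval ⟪ b ⟫ (λ u → g (v ++ u)))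
        ≡⟨ eval-⟪⟫ a _ ⟩
      Free.eval (normalise a) (λ m → eval (substitute m) (λ v → eval ⟪ b ⟫ (λ u → g (v ++ u))))
        ≡⟨ Free.eval-cong (normalise a) inner ⟩
      Free.eval (normalise a) (λ m → Free.eval (normalise b) (λ m′ → eval (substitute (m ++ m′)) g))
        ≡⟨ Free.eval-⊠ (normalise a) (normalise b) _ ⟨
      Free.eval (normalise (a :* b)) (λ m → eval (substitute m) g) ∎
      where
      inner : ∀ m → eval (substitute m) (λ v → eval ⟪ b ⟫ (λ u → g (v ++ u)))
                    ≡ Free.eval (normalise b) (λ m′ → eval (substitute (m ++ m′)) g)
      inner m = begin
        eval (substitute m) (λ v → eval ⟪ b ⟫ (λ u → g (v ++ u)))
          ≡⟨ eval-cong (substitute m) (λ v → eval-⟪⟫ b (λ u → g (v ++ u))) ⟩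
        eval (substitute m) (λ v → Free.eval (normalise b) (λ m′ → eval (substitute m′) (λ u → g (v ++ u))))
          ≡⟨ eval-swap (substitute m) (normalise b) (λ v m′ → eval (substitute m′) (λ u → g (v ++ u))) ⟩
        Free.eval (normalise b) (λ m′ → eval (substitute m) (λ v → eval (substitute m′) (λ u → g (v ++ u))))
          ≡⟨ Free.eval-cong (normalise b) (λ m′ → eval-substitute-++ m m′ g) ⟨
        Free.eval (normalise b) (λ m′ → eval (substitute (m ++ m′)) g) ∎
    eval-⟪⟫ :0 g = refl
    eval-⟪⟫ :1 g = sym (Free.eval-mono [] (λ m → eval (substitute m) g))

    prove : ∀ l r → Pairing.CoeffsAgree k (normalise l) (normalise r) → ⟪ l ⟫ ∼ ⟪ r ⟫
    prove l r agree = mk∼ λ g → begin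
      eval ⟪ l ⟫ g                                            ≡⟨ eval-⟪⟫ l g ⟩
      Free.eval (normalise l) (λ m → eval (substitute m) g)   ≡⟨ Free.eval-≡ (Free.coeffsAgree⇒∼ {normalise l} {normalise r} agree) _ ⟩
      Free.eval (normalise r) (λ m → eval (substitute m) g)   ≡⟨ eval-⟪⟫ r g ⟨
      eval ⟪ r ⟫ g                                            ∎

  solve : ∀ {N} k (f : N-ary k (Expr k) (Expr k × Expr k)) (ρ : Vec (Poly N) k) →
          let (l , r) = f $ⁿ Vec.map atom (Vec.allFin k) in
          {True (Pairing.coeffsAgree? k (normalise l) (normalise r))} → Pairing._∼_ N (⟪ ρ ⟫ l) (⟪ ρ ⟫ r)
  solve k f ρ {agree} = let (l , r) = f $ⁿ Vec.map atom (Vec.allFin k) in prove ρ l r (toWitness agree)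

module IdealClosure (N : ℕ) where
  open Pairing N
  open Solver

  resp∼ : ∀ {p q} → p ∼ q → InIdeal N p → InIdeal N q
  resp∼ p∼q = resp (∼⇒≈ p∼q)

  ∈-∼0 : ∀ {p} → p ∼ 0ᵤ N → InIdeal N p
  ∈-∼0 p∼0 = resp∼ (∼-sym p∼0) nil

  term : ℤ → Word N → Poly N
  term c v = (c , v) ∷ []

  sandwich : ℤ → Word N → Poly N → Word N → Poly N
  sandwich c l g r = scale N c (mono N l ⊠ (g ⊠ mono N r))

  eval-term-⊠ : ∀ c v p h → eval (term c v ⊠ p) h ≡ c * eval p (λ u → h (v ++ u))
  eval-term-⊠ c v p h = trans (eval-⊠ (term c v) p h) (+-identityʳ _)

  eval-⊠-term : ∀ p c v h → eval (p ⊠ term c v) h ≡ c * eval p (λ u → h (u ++ v))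
  eval-⊠-term p c v h = begin
    eval (p ⊠ term c v) h                        ≡⟨ eval-⊠ p (term c v) h ⟩
    eval p (λ u → c * h (u ++ v) + + 0)          ≡⟨ eval-cong p (λ u → +-identityʳ _) ⟩
    eval p (λ u → c * h (u ++ v))                ≡⟨ eval-*ˡ p c (λ u → h (u ++ v)) ⟩
    c * eval p (λ u → h (u ++ v))                ∎

  eval-sandwich : ∀ c l g r h → eval (sandwich c l g r) h ≡ c * eval g (λ u → h (l ++ u ++ r))
  eval-sandwich c l g r h = begin
    eval (sandwich c l g r) h                    ≡⟨ eval-scale c (mono N l ⊠ (g ⊠ mono N r)) h ⟩
    c * eval (mono N l ⊠ (g ⊠ mono N r)) h       ≡⟨ cong (c *_) (eval-mono-⊠ l (g ⊠ mono N r) h) ⟩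
    c * eval (g ⊠ mono N r) (λ u → h (l ++ u))   ≡⟨ cong (c *_) (eval-⊠-mono g r (λ u → h (l ++ u))) ⟩
    c * eval g (λ u → h (l ++ u ++ r))           ∎

  term-⊠-sandwich : ∀ d v c l g r → term d v ⊠ sandwich c l g r ∼ sandwich (d * c) (v ++ l) g r
  term-⊠-sandwich d v c l g r = mk∼ λ h → begin
    eval (term d v ⊠ sandwich c l g r) h              ≡⟨ eval-term-⊠ d v (sandwich c l g r) h ⟩
    d * eval (sandwich c l g r) (λ u → h (v ++ u))    ≡⟨ cong (d *_) (eval-sandwich c l g r _) ⟩
    d * (c * eval g (λ u → h (v ++ (l ++ u ++ r))))   ≡⟨ *-assoc d c _ ⟨
    d * c * eval g (λ u → h (v ++ (l ++ u ++ r)))     ≡⟨ cong (d * c *_) (eval-cong g (λ u → cong h (++-assoc v l (u ++ r)))) ⟨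
    d * c * eval g (λ u → h ((v ++ l) ++ u ++ r))     ≡⟨ eval-sandwich (d * c) (v ++ l) g r h ⟨
    eval (sandwich (d * c) (v ++ l) g r) h            ∎

  sandwich-⊠-term : ∀ c l g r d v → sandwich c l g r ⊠ term d v ∼ sandwich (d * c) l g (r ++ v)
  sandwich-⊠-term c l g r d v = mk∼ λ h → begin
    eval (sandwich c l g r ⊠ term d v) h              ≡⟨ eval-⊠-term (sandwich c l g r) d v h ⟩
    d * eval (sandwich c l g r) (λ u → h (u ++ v))    ≡⟨ cong (d *_) (eval-sandwich c l g r _) ⟩
    d * (c * eval g (λ u → h ((l ++ u ++ r) ++ v)))   ≡⟨ *-assoc d c _ ⟨
    d * c * eval g (λ u → h ((l ++ u ++ r) ++ v))     ≡⟨ cong (d * c *_) (eval-cong g (λ u → cong h (reassoc u))) ⟩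
    d * c * eval g (λ u → h (l ++ u ++ r ++ v))       ≡⟨ eval-sandwich (d * c) l g (r ++ v) h ⟨
    eval (sandwich (d * c) l g (r ++ v)) h            ∎
    where
    reassoc : ∀ u → (l ++ u ++ r) ++ v ≡ l ++ u ++ r ++ v
    reassoc u = trans (++-assoc l (u ++ r) v) (cong (l ++_) (++-assoc u r v))

  ∈-gen : ∀ {g} → IsGen N g → InIdeal N g
  ∈-gen {g} isGen = resp∼ sandwich≈g (addGen isGen (+ 1) [] [] nil)
    where
    sandwich≈g : sandwich (+ 1) [] g [] ⊞ 0ᵤ N ∼ g
    sandwich≈g = mk∼ λ h → begin
      eval (sandwich (+ 1) [] g [] ⊞ []) h       ≡⟨ eval-⊞ (sandwich (+ 1) [] g []) [] h ⟩
      eval (sandwich (+ 1) [] g []) h + + 0      ≡⟨ +-identityʳ _ ⟩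
      eval (sandwich (+ 1) [] g []) h            ≡⟨ eval-sandwich (+ 1) [] g [] h ⟩
      + 1 * eval g (λ u → h (u ++ []))           ≡⟨ *-identityˡ _ ⟩
      eval g (λ u → h (u ++ []))                 ≡⟨ eval-cong g (λ u → cong h (++-identityʳ u)) ⟩
      eval g h                                   ∎

  ∈-⊞ : ∀ {p q} → InIdeal N p → InIdeal N q → InIdeal N (p ⊞ q)
  ∈-⊞ nil q∈I = q∈I
  ∈-⊞ {q = q} (addGen {g} {p} isGen c l r p∈I) q∈I =
    subst (InIdeal N) (sym (++-assoc (sandwich c l g r) p q)) (addGen isGen c l r (∈-⊞ p∈I q∈I))
  ∈-⊞ {q = q} (resp {p} {p′} p≈p′ p∈I) q∈I = resp∼ (⊞-cong (≈⇒∼ {p} {p′} p≈p′) (∼-refl {q})) (∈-⊞ p∈I q∈I)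

  ∈-term-⊠ : ∀ d v {p} → InIdeal N p → InIdeal N (term d v ⊠ p)
  ∈-term-⊠ d v nil = nil
  ∈-term-⊠ d v (addGen {g} {p} isGen c l r p∈I) =
    resp∼ (∼-trans (⊞-cong (∼-sym (term-⊠-sandwich d v c l g r)) ∼-refl) (∼-sym distrib))
          (addGen isGen (d * c) (v ++ l) r (∈-term-⊠ d v p∈I))
    where
    distrib : term d v ⊠ (sandwich c l g r ⊞ p) ∼ term d v ⊠ sandwich c l g r ⊞ term d v ⊠ p
    distrib = solve 3 (λ t s p → t :* (s :+ p) , t :* s :+ t :* p) (term d v ∷ sandwich c l g r ∷ p ∷ [])
  ∈-term-⊠ d v (resp {p} {p′} p≈p′ p∈I) = resp∼ (⊠-cong (∼-refl {term d v}) (≈⇒∼ {p} {p′} p≈p′)) (∈-term-⊠ d v p∈I)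

  ∈-⊠-term : ∀ d v {p} → InIdeal N p → InIdeal N (p ⊠ term d v)
  ∈-⊠-term d v nil = nil
  ∈-⊠-term d v (addGen {g} {p} isGen c l r p∈I) =
    resp∼ (∼-trans (⊞-cong (∼-sym (sandwich-⊠-term c l g r d v)) ∼-refl) (∼-sym distrib))
          (addGen isGen (d * c) l (r ++ v) (∈-⊠-term d v p∈I))
    where
    distrib : (sandwich c l g r ⊞ p) ⊠ term d v ∼ sandwich c l g r ⊠ term d v ⊞ p ⊠ term d v
    distrib = solve 3 (λ s p t → (s :+ p) :* t , s :* t :+ p :* t) (sandwich c l g r ∷ p ∷ term d v ∷ [])
  ∈-⊠-term d v (resp {p} {p′} p≈p′ p∈I) = resp∼ (⊠-cong (≈⇒∼ {p} {p′} p≈p′) (∼-refl {term d v})) (∈-⊠-term d v p∈I)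

  ∈-⊠ˡ : ∀ q {p} → InIdeal N p → InIdeal N (q ⊠ p)
  ∈-⊠ˡ []            p∈I = nil
  ∈-⊠ˡ ((c , v) ∷ q) {p} p∈I = resp∼ (∼-sym distrib) (∈-⊞ (∈-term-⊠ c v p∈I) (∈-⊠ˡ q p∈I))
    where
    distrib : (term c v ⊞ q) ⊠ p ∼ term c v ⊠ p ⊞ q ⊠ p
    distrib = solve 3 (λ t q p → (t :+ q) :* p , t :* p :+ q :* p) (term c v ∷ q ∷ p ∷ [])

  ∈-⊠ʳ : ∀ q {p} → InIdeal N p → InIdeal N (p ⊠ q)
  ∈-⊠ʳ []            {p} p∈I = ∈-∼0 (solve 1 (λ p → p :* :0 , :0) (p ∷ []))
  ∈-⊠ʳ ((c , v) ∷ q) {p} p∈I = resp∼ (∼-sym distrib) (∈-⊞ (∈-⊠-term c v p∈I) (∈-⊠ʳ q p∈I))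
    where
    distrib : p ⊠ (term c v ⊞ q) ∼ p ⊠ term c v ⊞ p ⊠ q
    distrib = solve 3 (λ p t q → p :* (t :+ q) , p :* t :+ p :* q) (p ∷ term c v ∷ q ∷ [])

  ∈-⊟ : ∀ {p q} → InIdeal N p → InIdeal N q → InIdeal N (p ⊟ q)
  ∈-⊟ {p} {q} p∈I q∈I = ∈-⊞ p∈I (resp∼ negate (∈-term-⊠ -[1+ 0 ] [] q∈I))
    where
    negate : term -[1+ 0 ] [] ⊠ q ∼ scale N -[1+ 0 ] q
    negate = mk∼ λ h → trans (eval-term-⊠ -[1+ 0 ] [] q h) (sym (eval-scale -[1+ 0 ] q h))

module Commutation (N : ℕ) where
  open Pairing N
  open Solver
  open IdealClosure N

  u : Letter N → Poly N
  u = var N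

  ⟦_,_⟧ : Poly N → Poly N → Poly N
  ⟦ p , q ⟧ = p ⊠ q ⊟ q ⊠ p

  ⟦,⟧-cong : ∀ {p p′ q q′} → p ∼ p′ → q ∼ q′ → ⟦ p , q ⟧ ∼ ⟦ p′ , q′ ⟧
  ⟦,⟧-cong p∼p′ q∼q′ = ⊟-cong (⊠-cong p∼p′ q∼q′) (⊠-cong q∼q′ p∼p′)

  ¬Unique-∷-∷ʳ : ∀ (x : Letter N) w → ¬ Unique (x ∷ w ++ x ∷ [])
  ¬Unique-∷-∷ʳ x w (x∉w∷ʳx ∷ _) with All.++⁻ʳ w x∉w∷ʳx
  ... | x≢x ∷ [] = x≢x refl

  u-⊠-⊠-u∈I : ∀ x p → InIdeal N (u x ⊠ p ⊠ u x)
  u-⊠-⊠-u∈I x []            = nil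
  u-⊠-⊠-u∈I x ((c , w) ∷ p) = resp∼ (∼-sym distrib) (∈-⊞ repeated (u-⊠-⊠-u∈I x p))
    where
    distrib : u x ⊠ (term c w ⊞ p) ⊠ u x ∼ u x ⊠ term c w ⊠ u x ⊞ u x ⊠ p ⊠ u x
    distrib = solve 3 (λ x t p → x :* (t :+ p) :* x , x :* t :* x :+ x :* p :* x) (u x ∷ term c w ∷ p ∷ [])
    repeated : InIdeal N (u x ⊠ term c w ⊠ u x)
    repeated = subst (λ c′ → InIdeal N (term c′ (x ∷ w ++ x ∷ [])))
                     (trans (*-identityʳ c) (sym (trans (*-identityʳ _) (*-identityˡ c))))
                     (∈-term-⊠ c [] (∈-gen (rep (¬Unique-∷-∷ʳ x w))))

  u-⊠-⊠-u-⊠∈I : ∀ x p q → InIdeal N (u x ⊠ p ⊠ (u x ⊠ q))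
  u-⊠-⊠-u-⊠∈I x p q = resp∼ (solve 3 (λ x p q → x :* p :* x :* q , x :* p :* (x :* q)) (u x ∷ p ∷ q ∷ []))
                          (∈-⊠ʳ q (u-⊠-⊠-u∈I x p))

  -- Holds when every word of z contains a: then a ⋯ z has a repeated letter.
  Absorbed : Letter N → Poly N → Set
  Absorbed a z = ∀ y → InIdeal N (u a ⊠ y ⊠ z)

  absorbed-0ᵤ : ∀ a → Absorbed a (0ᵤ N)
  absorbed-0ᵤ a y = ∈-∼0 (solve 2 (λ a y → a :* y :* :0 , :0) (u a ∷ y ∷ []))

  absorbed-⊞ : ∀ {a z z′} → Absorbed a z → Absorbed a z′ → Absorbed a (z ⊞ z′)
  absorbed-⊞ {a} {z} {z′} az az′ y =
    resp∼ (solve 4 (λ a y z z′ → a :* y :* z :+ a :* y :* z′ , a :* y :* (z :+ z′)) (u a ∷ y ∷ z ∷ z′ ∷ []))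
          (∈-⊞ (az y) (az′ y))

  absorbed-u-⊠ : ∀ {a z} x → Absorbed a z → Absorbed a (u x ⊠ z)
  absorbed-u-⊠ {a} {z} x az y =
    resp∼ (solve 4 (λ a y x z → a :* (y :* x) :* z , a :* y :* (x :* z)) (u a ∷ y ∷ u x ∷ z ∷ []))
          (az (y ⊠ u x))

  absorbed-u-self : ∀ a p → Absorbed a (u a ⊠ p)
  absorbed-u-self a p y = u-⊠-⊠-u-⊠∈I a y p

  ⟦-,u⟧-⊠-absorbed : ∀ {a z} → Absorbed a z → ∀ p y → InIdeal N (⟦ p , u a ⟧ ⊠ y ⊠ z)
  ⟦-,u⟧-⊠-absorbed {a} {z} az p y =
    resp∼ (solve 4 (λ p a y z → p :* (a :* y :* z) :- a :* (p :* y) :* z , :[ p , a ] :* y :* z)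
                   (p ∷ u a ∷ y ∷ z ∷ []))
          (∈-⊟ (∈-⊠ˡ p (az y)) (az (p ⊠ y)))

  sumWords : List (Word N) → Poly N
  sumWords = map (λ w → (+ 1 , w))

  choose : ℕ → List (Letter N) → List (Word N)
  choose zero    S       = [] ∷ []
  choose (suc d) []      = []
  choose (suc d) (x ∷ S) = map (x ∷_) (choose d S) ++ choose (suc d) S

  E : ℕ → List (Letter N) → Poly N
  E d S = sumWords (choose d S)

  u-⊠-sumWords : ∀ x ws → u x ⊠ sumWords ws ≡ sumWords (map (x ∷_) ws)
  u-⊠-sumWords x []       = refl
  u-⊠-sumWords x (w ∷ ws) = cong ((+ 1 , x ∷ w) ∷_) (u-⊠-sumWords x ws)

  E-suc : ∀ d x S → E (suc d) (x ∷ S) ≡ u x ⊠ E d S ⊞ E (suc d) S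
  E-suc d x S = begin
    sumWords (map (x ∷_) (choose d S) ++ choose (suc d) S)          ≡⟨ map-++ _ (map (x ∷_) (choose d S)) _ ⟩
    sumWords (map (x ∷_) (choose d S)) ⊞ E (suc d) S                ≡⟨ cong (_⊞ E (suc d) S) (u-⊠-sumWords x (choose d S)) ⟨
    u x ⊠ E d S ⊞ E (suc d) S                                        ∎

  E-remove : ∀ P a Q m → Σ[ z ∈ Poly N ] (E m (P ++ a ∷ Q) ∼ E m (P ++ Q) ⊞ z × Absorbed a z)
  E-remove P       a Q zero    = 0ᵤ N , solve 1 (λ e → e , e :+ :0) (E zero Q ∷ []) , absorbed-0ᵤ a
  E-remove []      a Q (suc m) =
    u a ⊠ E m Q ,
    ∼-trans (≡⇒∼ (E-suc m a Q)) (solve 2 (λ z e → z :+ e , e :+ z) (u a ⊠ E m Q ∷ E (suc m) Q ∷ [])) ,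
    absorbed-u-self a (E m Q)
  E-remove (p ∷ P) a Q (suc m) with E-remove P a Q m | E-remove P a Q (suc m)
  ... | z , E≈ , az | z′ , E′≈ , az′ =
    u p ⊠ z ⊞ z′ ,
    ∼-trans (≡⇒∼ (E-suc m p (P ++ a ∷ Q)))
      (∼-trans (⊞-cong (⊠-cong (∼-refl {u p}) E≈) E′≈)
        (∼-trans (solve 5 (λ p e z e′ z′ → p :* (e :+ z) :+ (e′ :+ z′) , (p :* e :+ e′) :+ (p :* z :+ z′))
                          (u p ∷ E m (P ++ Q) ∷ z ∷ E (suc m) (P ++ Q) ∷ z′ ∷ []))
                 (⊞-cong (≡⇒∼ (sym (E-suc m p (P ++ Q)))) ∼-refl))) ,
    absorbed-⊞ (absorbed-u-⊠ p az) az′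

  ∑ : {A : Set} → (A → Poly N) → List A → Poly N
  ∑ f []       = 0ᵤ N
  ∑ f (x ∷ xs) = f x ⊞ ∑ f xs

  module _ {A : Set} where

    ∑-map : ∀ {B : Set} (f : B → Poly N) (g : A → B) xs → ∑ f (map g xs) ≡ ∑ (f ∘ g) xs
    ∑-map f g []       = refl
    ∑-map f g (x ∷ xs) = cong (f (g x) ⊞_) (∑-map f g xs)

    ∑-cong : ∀ {f g : A → Poly N} xs → (∀ x → f x ∼ g x) → ∑ f xs ∼ ∑ g xs
    ∑-cong []       f∼g = ∼-refl
    ∑-cong (x ∷ xs) f∼g = ⊞-cong (f∼g x) (∑-cong xs f∼g)

    ∑-⊞ : ∀ (f g : A → Poly N) xs → ∑ (λ x → f x ⊞ g x) xs ∼ ∑ f xs ⊞ ∑ g xs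
    ∑-⊞ f g []       = solve 0 (:0 , :0 :+ :0) []
    ∑-⊞ f g (x ∷ xs) =
      ∼-trans (⊞-cong (∼-refl {f x ⊞ g x}) (∑-⊞ f g xs))
        (solve 4 (λ a b s t → a :+ b :+ (s :+ t) , a :+ s :+ (b :+ t)) (f x ∷ g x ∷ ∑ f xs ∷ ∑ g xs ∷ []))

    ∑-⊟ : ∀ (f g : A → Poly N) xs → ∑ f xs ⊟ ∑ g xs ∼ ∑ (λ x → f x ⊟ g x) xs
    ∑-⊟ f g []       = solve 0 (:0 :- :0 , :0) []
    ∑-⊟ f g (x ∷ xs) =
      ∼-trans (solve 4 (λ a b s t → a :+ s :- (b :+ t) , a :- b :+ (s :- t)) (f x ∷ g x ∷ ∑ f xs ∷ ∑ g xs ∷ []))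
        (⊞-cong (∼-refl {f x ⊟ g x}) (∑-⊟ f g xs))

    ⊠-∑ : ∀ p (f : A → Poly N) xs → p ⊠ ∑ f xs ∼ ∑ (λ x → p ⊠ f x) xs
    ⊠-∑ p f []       = solve 1 (λ p → p :* :0 , :0) (p ∷ [])
    ⊠-∑ p f (x ∷ xs) =
      ∼-trans (solve 3 (λ p a s → p :* (a :+ s) , p :* a :+ p :* s) (p ∷ f x ∷ ∑ f xs ∷ []))
        (⊞-cong (∼-refl {p ⊠ f x}) (⊠-∑ p f xs))

    ∑-⊠ : ∀ (f : A → Poly N) xs p → ∑ f xs ⊠ p ∼ ∑ (λ x → f x ⊠ p) xs
    ∑-⊠ f []       p = ∼-refl
    ∑-⊠ f (x ∷ xs) p =
      ∼-trans (solve 3 (λ a s p → (a :+ s) :* p , a :* p :+ s :* p) (f x ∷ ∑ f xs ∷ p ∷ []))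
        (⊞-cong (∼-refl {f x ⊠ p}) (∑-⊠ f xs p))

    ∈-∑ : ∀ {f : A → Poly N} xs → (∀ {x} → x ∈ xs → InIdeal N (f x)) → InIdeal N (∑ f xs)
    ∈-∑ []       f∈I = nil
    ∈-∑ (x ∷ xs) f∈I = ∈-⊞ (f∈I (here refl)) (∈-∑ xs (f∈I ∘ there))

  Decreasing : List (Letter N) → Set
  Decreasing = AllPairs _>_

  Split : Set
  Split = List (Letter N) × Letter N × List (Letter N)

  splits : List (Letter N) → List Split
  splits []      = []
  splits (x ∷ T) = ([] , x , T) ∷ map (λ (P , a , Q) → (x ∷ P , a , Q)) (splits T)

  splits-join : ∀ {T P a Q} → (P , a , Q) ∈ splits T → P ++ a ∷ Q ≡ T
  splits-join {x ∷ T} (here refl) = refl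
  splits-join {x ∷ T} (there t∈) with ∈-map⁻ _ t∈
  ... | _ , t′∈ , refl = cong (x ∷_) (splits-join t′∈)

  splits-∈ : ∀ {T P a Q} → (P , a , Q) ∈ splits T → a ∈ T
  splits-∈ {P = P} t∈ = subst (_ ∈_) (splits-join t∈) (∈-++⁺ʳ P (here refl))

  module _ (n : Letter N) where

    commutators : ℕ → List Split → Poly N
    commutators k = ∑ (λ (P , a , Q) → ⟦ u n , u a ⟧ ⊠ E k (P ++ Q))

    u-⊠-commutators≡ᴵ : ∀ {x T} k → x < n → All (_< x) T →
                      InIdeal N (u x ⊠ commutators k (splits T)
                                 ⊟ ∑ (λ (P , a , Q) → ⟦ u n , u a ⟧ ⊠ (u x ⊠ E k (P ++ Q))) (splits T))
    u-⊠-commutators≡ᴵ {x} {T} k x<n T<x =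
      resp∼ (∼-sym (∼-trans (⊟-cong (⊠-∑ (u x) _ (splits T)) ∼-refl) (∑-⊟ _ _ (splits T))))
            (∈-∑ (splits T) commutes)
      where
      commutes : ∀ {t} → t ∈ splits T → let (P , a , Q) = t in
                 InIdeal N (u x ⊠ (⟦ u n , u a ⟧ ⊠ E k (P ++ Q)) ⊟ ⟦ u n , u a ⟧ ⊠ (u x ⊠ E k (P ++ Q)))
      commutes {P , a , Q} t∈ =
        resp∼ (solve 4 (λ n a x e → (:0 :- (x :* :[ a , n ] :- :[ a , n ] :* x)) :* e ,
                                    x :* (:[ n , a ] :* e) :- :[ n , a ] :* (x :* e))
                       (u n ∷ u a ∷ u x ∷ E k (P ++ Q) ∷ []))
              (∈-⊠ʳ (E k (P ++ Q)) (∈-⊟ nil (∈-gen (comm (All.lookup T<x (splits-∈ t∈)) x<n))))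

    ⟦u,E⟧≡ᴵcommutators : ∀ {T} → Decreasing T → All (_< n) T → ∀ k →
                          InIdeal N (⟦ u n , E (suc k) T ⟧ ⊟ commutators k (splits T))
    ⟦u,E⟧≡ᴵcommutators {[]}    _           _           k = nil
    ⟦u,E⟧≡ᴵcommutators {x ∷ T} (T<x ∷ T↓) (x<n ∷ T<n) k =
      subst (λ D → InIdeal N (⟦ u n , E (suc k) (x ∷ T) ⟧ ⊟ (⟦ u n , u x ⟧ ⊠ E k T ⊞ D)))
            (sym (∑-map (λ (P , a , Q) → ⟦ u n , u a ⟧ ⊠ E k (P ++ Q)) (λ (P , a , Q) → (x ∷ P , a , Q)) (splits T)))
            (resp∼ (∼-sym (expand k)) (shifted k))
      where
      shiftedCommutators : ℕ → Poly N
      shiftedCommutators k = ∑ (λ (P , a , Q) → ⟦ u n , u a ⟧ ⊠ E k (x ∷ P ++ Q)) (splits T)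

      expand : ∀ k → ⟦ u n , E (suc k) (x ∷ T) ⟧ ⊟ (⟦ u n , u x ⟧ ⊠ E k T ⊞ shiftedCommutators k)
                     ∼ u x ⊠ ⟦ u n , E k T ⟧ ⊞ ⟦ u n , E (suc k) T ⟧ ⊟ shiftedCommutators k
      expand k rewrite E-suc k x T =
        solve 5 (λ n x e e′ d → :[ n , x :* e :+ e′ ] :- (:[ n , x ] :* e :+ d) , x :* :[ n , e ] :+ :[ n , e′ ] :- d)
                (u n ∷ u x ∷ E k T ∷ E (suc k) T ∷ shiftedCommutators k ∷ [])

      reassoc : ∀ a b c → a ⊞ (b ⊟ c) ∼ a ⊞ b ⊟ c
      reassoc a b c = solve 3 (λ a b c → a :+ (b :- c) , a :+ b :- c) (a ∷ b ∷ c ∷ [])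

      shifted : ∀ k → InIdeal N (u x ⊠ ⟦ u n , E k T ⟧ ⊞ ⟦ u n , E (suc k) T ⟧ ⊟ shiftedCommutators k)
      shifted zero =
        resp∼ (reassoc (u x ⊠ ⟦ u n , 1ᵤ N ⟧) ⟦ u n , E 1 T ⟧ (commutators 0 (splits T)))
          (∈-⊞ (∈-⊠ˡ (u x) (∈-∼0 (solve 1 (λ n → :[ n , :1 ] , :0) (u n ∷ []))))
               (⟦u,E⟧≡ᴵcommutators T↓ T<n zero))
      shifted (suc k) =
        resp∼ (∼-trans (solve 6 (λ x a b c d c′ → x :* (a :- c) :+ (x :* c :- d) :+ (b :- c′) , x :* a :+ b :- (d :+ c′))
                                (u x ∷ ⟦ u n , E (suc k) T ⟧ ∷ ⟦ u n , E (suc (suc k)) T ⟧ ∷ commutators k (splits T)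
                                     ∷ ∑ (λ (P , a , Q) → ⟦ u n , u a ⟧ ⊠ (u x ⊠ E k (P ++ Q))) (splits T)
                                     ∷ commutators (suc k) (splits T) ∷ []))
                       (⊟-cong ∼-refl (∼-sym split)))
          (∈-⊞ (∈-⊞ (∈-⊠ˡ (u x) (⟦u,E⟧≡ᴵcommutators T↓ T<n k)) (u-⊠-commutators≡ᴵ k x<n T<x))
               (⟦u,E⟧≡ᴵcommutators T↓ T<n (suc k)))
        where
        split : shiftedCommutators (suc k)
                ∼ ∑ (λ (P , a , Q) → ⟦ u n , u a ⟧ ⊠ (u x ⊠ E k (P ++ Q))) (splits T) ⊞ commutators (suc k) (splits T)
        split = ∼-trans (∑-cong (splits T) distrib) (∑-⊞ _ _ (splits T))
          where
          distrib : ∀ ((P , a , Q) : Split) → ⟦ u n , u a ⟧ ⊠ E (suc k) (x ∷ P ++ Q)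
                                              ∼ ⟦ u n , u a ⟧ ⊠ (u x ⊠ E k (P ++ Q)) ⊞ ⟦ u n , u a ⟧ ⊠ E (suc k) (P ++ Q)
          distrib (P , a , Q) rewrite E-suc k x (P ++ Q) =
            solve 4 (λ c x e e′ → c :* (x :* e :+ e′) , c :* (x :* e) :+ c :* e′)
                    (⟦ u n , u a ⟧ ∷ u x ∷ E k (P ++ Q) ∷ E (suc k) (P ++ Q) ∷ [])

    cross-terms∈I : ∀ {S} → (∀ {P a Q} → P ++ a ∷ Q ≡ S → ∀ i j → InIdeal N ⟦ E i (P ++ Q) , E j (P ++ Q) ⟧) →
                  ∀ i j → InIdeal N (commutators j (splits S) ⊠ E i S ⊟ commutators i (splits S) ⊠ E j S)
    cross-terms∈I {S} IH i j =
      resp∼ (∼-sym (∼-trans (⊟-cong (∑-⊠ _ (splits S) (E i S)) (∑-⊠ _ (splits S) (E j S))) (∑-⊟ _ _ (splits S))))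
            (∈-∑ (splits S) summand)
      where
      summand : ∀ {t} → t ∈ splits S → let (P , a , Q) = t in
                InIdeal N (⟦ u n , u a ⟧ ⊠ E j (P ++ Q) ⊠ E i S ⊟ ⟦ u n , u a ⟧ ⊠ E i (P ++ Q) ⊠ E j S)
      summand {P , a , Q} t∈ with E-remove P a Q i | E-remove P a Q j
      ... | zᵢ , Eᵢ≈ , azᵢ | zⱼ , Eⱼ≈ , azⱼ =
        resp∼ (∼-sym (∼-trans (⊟-cong (⊠-cong (∼-refl {c ⊠ Eⱼ}) (at-S {i} Eᵢ≈)) (⊠-cong (∼-refl {c ⊠ Eᵢ}) (at-S {j} Eⱼ≈)))
                              (solve 5 (λ c eⱼ eᵢ zᵢ zⱼ → c :* eⱼ :* (eᵢ :+ zᵢ) :- c :* eᵢ :* (eⱼ :+ zⱼ) ,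
                                                          c :* :[ eⱼ , eᵢ ] :+ (c :* eⱼ :* zᵢ :- c :* eᵢ :* zⱼ))
                                       (c ∷ Eⱼ ∷ Eᵢ ∷ zᵢ ∷ zⱼ ∷ []))))
              (∈-⊞ (∈-⊠ˡ c (IH (splits-join t∈) j i))
                   (∈-⊟ (⟦-,u⟧-⊠-absorbed azᵢ (u n) Eⱼ) (⟦-,u⟧-⊠-absorbed azⱼ (u n) Eᵢ)))
        where
        c Eᵢ Eⱼ : Poly N
        c = ⟦ u n , u a ⟧
        Eᵢ = E i (P ++ Q)
        Eⱼ = E j (P ++ Q)
        at-S : ∀ {m z} → E m (P ++ a ∷ Q) ∼ E m (P ++ Q) ⊞ z → E m S ∼ E m (P ++ Q) ⊞ z
        at-S {m} {z} = subst (λ S′ → E m S′ ∼ E m (P ++ Q) ⊞ z) (splits-join t∈)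

  All-remove : ∀ {R : Letter N → Set} P {a Q} → All R (P ++ a ∷ Q) → All R (P ++ Q)
  All-remove P R* = All.++⁺ (All.++⁻ˡ P R*) (All.tail (All.++⁻ʳ P R*))

  Decreasing-remove : ∀ P {a Q} → Decreasing (P ++ a ∷ Q) → Decreasing (P ++ Q)
  Decreasing-remove []      (_ ∷ ↓)  = ↓
  Decreasing-remove (p ∷ P) (p>* ∷ ↓) = All-remove P p>* ∷ Decreasing-remove P ↓

  length-remove : ∀ P {a : Letter N} {Q} → length (P ++ Q) ℕ.< length (P ++ a ∷ Q)
  length-remove []      = ℕ.n<1+n _
  length-remove (p ∷ P) = ℕ.s≤s (length-remove P)

  -- Fuel bounds |S|: the induction hypothesis is also needed for S with its largest letter n
  -- and one further letter a removed, which is not a structural subterm of S.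
  E-commute : ∀ fuel {S} → length S ℕ.< fuel → Decreasing S → ∀ i j → InIdeal N ⟦ E i S , E j S ⟧
  E-commute (suc fuel) {S}  _ _ zero    j       = ∈-∼0 (solve 1 (λ e → :[ :1 , e ] , :0) (E j S ∷ []))
  E-commute (suc fuel) {S}  _ _ (suc i) zero    = ∈-∼0 (solve 1 (λ e → :[ e , :1 ] , :0) (E (suc i) S ∷ []))
  E-commute (suc fuel) {[]} _ _ (suc i) (suc j) = nil
  E-commute (suc fuel) {n ∷ S} (ℕ.s≤s |S|<fuel) (S<n ∷ S↓) (suc i) (suc j) =
    resp∼ (∼-sym (∼-trans (⟦,⟧-cong (≡⇒∼ (E-suc i n S)) (≡⇒∼ (E-suc j n S))) decomposition))
      (∈-⊞ (∈-⊞ (∈-⊞ (∈-⊞ (∈-⊟ (u-⊠-⊠-u-⊠∈I n Aᵢ Aⱼ) (u-⊠-⊠-u-⊠∈I n Aⱼ Aᵢ))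
                           (IH (suc i) (suc j)))
                      (∈-⊟ (∈-⊠ˡ (u n) (IH i (suc j))) (∈-⊠ˡ (u n) (IH j (suc i)))))
                 (∈-⊟ (∈-⊠ʳ Aᵢ (⟦u,E⟧≡ᴵcommutators n S↓ S<n j)) (∈-⊠ʳ Aⱼ (⟦u,E⟧≡ᴵcommutators n S↓ S<n i))))
           (cross-terms∈I n IH-removed i j))
    where
    IH : ∀ i j → InIdeal N ⟦ E i S , E j S ⟧
    IH = E-commute fuel |S|<fuel S↓
    IH-removed : ∀ {P a Q} → P ++ a ∷ Q ≡ S → ∀ i j → InIdeal N ⟦ E i (P ++ Q) , E j (P ++ Q) ⟧
    IH-removed {P} refl = E-commute fuel (ℕ.<-trans (length-remove P) |S|<fuel) (Decreasing-remove P S↓)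
    Aᵢ Aⱼ : Poly N
    Aᵢ = E i S
    Aⱼ = E j S
    Rᵢ Rⱼ : Poly N
    Rᵢ = commutators n i (splits S)
    Rⱼ = commutators n j (splits S)
    decomposition :
      ⟦ u n ⊠ Aᵢ ⊞ E (suc i) S , u n ⊠ Aⱼ ⊞ E (suc j) S ⟧
      ∼ (u n ⊠ Aᵢ ⊠ (u n ⊠ Aⱼ) ⊟ u n ⊠ Aⱼ ⊠ (u n ⊠ Aᵢ)) ⊞ ⟦ E (suc i) S , E (suc j) S ⟧
        ⊞ (u n ⊠ ⟦ Aᵢ , E (suc j) S ⟧ ⊟ u n ⊠ ⟦ Aⱼ , E (suc i) S ⟧)
        ⊞ ((⟦ u n , E (suc j) S ⟧ ⊟ Rⱼ) ⊠ Aᵢ ⊟ (⟦ u n , E (suc i) S ⟧ ⊟ Rᵢ) ⊠ Aⱼ)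
        ⊞ (Rⱼ ⊠ Aᵢ ⊟ Rᵢ ⊠ Aⱼ)
    decomposition =
      solve 7 (λ n aᵢ aⱼ aᵢ′ aⱼ′ rᵢ rⱼ →
                 :[ n :* aᵢ :+ aᵢ′ , n :* aⱼ :+ aⱼ′ ] ,
                 (n :* aᵢ :* (n :* aⱼ) :- n :* aⱼ :* (n :* aᵢ)) :+ :[ aᵢ′ , aⱼ′ ]
                   :+ (n :* :[ aᵢ , aⱼ′ ] :- n :* :[ aⱼ , aᵢ′ ])
                   :+ ((:[ n , aⱼ′ ] :- rⱼ) :* aᵢ :- (:[ n , aᵢ′ ] :- rᵢ) :* aⱼ)
                   :+ (rⱼ :* aᵢ :- rᵢ :* aⱼ))
              (u n ∷ Aᵢ ∷ Aⱼ ∷ E (suc i) S ∷ E (suc j) S ∷ Rᵢ ∷ Rⱼ ∷ [])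

module Enumeration (N : ℕ) where
  open Pairing N
  open Commutation N

  allLetters : List (Letter N)
  allLetters = tabulate opposite

  allLetters-decreasing : Decreasing allLetters
  allLetters-decreasing = AllPairs.tabulate⁺-< opposite-<
    where
    opposite-< : ∀ {i j : Fin N} → i < j → opposite j < opposite i
    opposite-< {i} {j} i<j = subst₂ ℕ._<_ (sym (Fin.opposite-prop j)) (sym (Fin.opposite-prop i))
                                    (ℕ.∸-monoʳ-< (ℕ.s≤s i<j) (Fin.toℕ<n j))

  ∈-allLetters : ∀ x → x ∈ allLetters
  ∈-allLetters x = subst (_∈ allLetters) (Fin.opposite-involutive x) (∈-tabulate⁺ (opposite x))

  ∈-choose⁻ : ∀ {d S w} → w ∈ choose d S → Decreasing S → length w ≡ d × Decreasing w × All (_∈ S) w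
  ∈-choose⁻ {zero}  (here refl) _ = refl , [] , []
  ∈-choose⁻ {suc d} {x ∷ S} w∈ (S<x ∷ S↓) with ∈-++⁻ (map (x ∷_) (choose d S)) w∈
  ... | inj₂ w∈′ with ∈-choose⁻ w∈′ S↓
  ...   | |w| , w↓ , w⊆S = |w| , w↓ , All.map there w⊆S
  ∈-choose⁻ {suc d} {x ∷ S} w∈ (S<x ∷ S↓) | inj₁ w∈′ with ∈-map⁻ (x ∷_) w∈′
  ... | w′ , w′∈ , refl with ∈-choose⁻ w′∈ S↓
  ...   | |w′| , w′↓ , w′⊆S = cong suc |w′| , All.map (All.lookup S<x) w′⊆S ∷ w′↓ , here refl ∷ All.map there w′⊆S

  ∈-∷-≢ : ∀ {A : Set} {s z : A} {S} → z ∈ s ∷ S → z ≢ s → z ∈ S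
  ∈-∷-≢ (here z≡s)  z≢s = contradiction z≡s z≢s
  ∈-∷-≢ (there z∈S) _   = z∈S

  ∈-∷-< : ∀ {s z : Letter N} {S} → z ∈ s ∷ S → z < s → z ∈ S
  ∈-∷-< z∈ z<s = ∈-∷-≢ z∈ (Fin.<⇒≢ z<s)

  ∈-choose⁺ : ∀ {d S w} → length w ≡ d → Decreasing w → All (_∈ S) w → Decreasing S → w ∈ choose d S
  ∈-choose⁺ {zero}  {w = []}    _   _          _            _           = here refl
  ∈-choose⁺ {suc d} {s ∷ S} {y ∷ w} |w| (w<y ∷ w↓) (y∈ ∷ w⊆) (S<s ∷ S↓) with y Fin.≟ s
  ... | yes refl =
    ∈-++⁺ˡ (∈-map⁺ (y ∷_) (∈-choose⁺ (ℕ.suc-injective |w|) w↓ (All.zipWith (uncurry ∈-∷-<) (w⊆ , w<y)) S↓))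
  ... | no y≢s   =
    ∈-++⁺ʳ _ (∈-choose⁺ |w| (w<y ∷ w↓) (y∈S ∷ All.zipWith (uncurry ∈-∷-<) (w⊆ , w<s)) S↓)
    where
    y∈S : y ∈ S
    y∈S = ∈-∷-≢ y∈ y≢s
    w<s : All (_< s) w
    w<s = All.map (λ z<y → Fin.<-trans z<y (All.lookup S<s y∈S)) w<y
  ∈-choose⁺ {suc d} {[]} {y ∷ w} _ _ (() ∷ _) _
  ∈-choose⁺ {zero}  {w = _ ∷ _} () _ _ _
  ∈-choose⁺ {suc d} {w = []} () _ _ _

  choose-unique : ∀ d {S} → Decreasing S → Unique (choose d S)
  choose-unique zero    _ = [] ∷ []
  choose-unique (suc d) {[]} _ = []
  choose-unique (suc d) {x ∷ S} (S<x ∷ S↓) =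
    Unique.++⁺ (Unique.map⁺ (proj₂ ∘ ∷-injective) (choose-unique d S↓)) (choose-unique (suc d) S↓) disjoint
    where
    disjoint : ∀ {w} → w ∈ map (x ∷_) (choose d S) × w ∈ choose (suc d) S → ⊥
    disjoint (w∈ , w∈′) with ∈-map⁻ (x ∷_) w∈
    ... | _ , _ , refl with ∈-choose⁻ {suc d} w∈′ S↓
    ...   | _ , _ , x∈S ∷ _ = Fin.<-irrefl refl (All.lookup S<x x∈S)

  words-cartesian : ∀ (xs : List (Letter N)) (ws : List (Word N)) →
                    concatMap (λ a → map (a ∷_) ws) xs ≡ cartesianProductWith List._∷_ xs ws
  words-cartesian []       ws = refl
  words-cartesian (x ∷ xs) ws = cong (map (x ∷_) ws ++_) (words-cartesian xs ws)

  words-unique : ∀ d → Unique (words N d)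
  words-unique zero    = [] ∷ []
  words-unique (suc d) =
    subst Unique (sym (words-cartesian (allFin N) (words N d)))
          (Unique.cartesianProductWith⁺ {xs = allFin N} {ys = words N d} List._∷_ ∷-injective
                                        (Unique.allFin⁺ N) (words-unique d))

  ∈-words⁻ : ∀ {d w} → w ∈ words N d → length w ≡ d
  ∈-words⁻ {zero}  (here refl) = refl
  ∈-words⁻ {suc d} w∈ with satisfied (∈-concatMap⁻ (λ a → map (a ∷_) (words N d)) {xs = allFin N} w∈)
  ... | a , w∈′ with ∈-map⁻ (a ∷_) w∈′
  ...   | w′ , w′∈ , refl = cong suc (∈-words⁻ w′∈)

  ∈-words⁺ : ∀ w → w ∈ words N (length w)
  ∈-words⁺ []      = here refl
  ∈-words⁺ (x ∷ w) = ∈-concatMap⁺ (λ a → map (a ∷_) (words N (length w))) {xs = allFin N}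
                                  (lose (∈-allFin x) (∈-map⁺ (x ∷_) (∈-words⁺ w)))

  coeff-sumWords-∉ : ∀ {ws w} → w ∉ ws → coeff N (sumWords ws) w ≡ + 0
  coeff-sumWords-∉ {[]}     w∉ = refl
  coeff-sumWords-∉ {v ∷ ws} {w} w∉ with _≟w_ N v w
  ... | yes refl = contradiction (here refl) w∉
  ... | no  _    = coeff-sumWords-∉ (w∉ ∘ there)

  coeff-sumWords-∈ : ∀ {ws w} → Unique ws → w ∈ ws → coeff N (sumWords ws) w ≡ + 1
  coeff-sumWords-∈ {v ∷ ws} {w} (v∉ws ∷ ws!) w∈ with _≟w_ N v w
  ... | yes refl = cong (_+_ (+ 1)) (coeff-sumWords-∉ (λ v∈ws → All.lookup v∉ws v∈ws refl))
  ... | no  v≢w  = coeff-sumWords-∈ ws! (∈-∷-≢ w∈ (v≢w ∘ sym))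

  sumWords-∼ : ∀ {ws vs} → Unique ws → Unique vs → (∀ {w} → w ∈ ws → w ∈ vs) → (∀ {w} → w ∈ vs → w ∈ ws) →
               sumWords ws ∼ sumWords vs
  sumWords-∼ {ws} {vs} ws! vs! ws⊆vs vs⊆ws = ≈⇒∼ same-coeff
    where
    same-coeff : ∀ w → coeff N (sumWords ws) w ≡ coeff N (sumWords vs) w
    same-coeff w with _∈?_ (_≟w_ N) w ws
    ... | yes w∈ = trans (coeff-sumWords-∈ ws! w∈) (sym (coeff-sumWords-∈ vs! (ws⊆vs w∈)))
    ... | no  w∉ = trans (coeff-sumWords-∉ w∉) (sym (coeff-sumWords-∉ (w∉ ∘ vs⊆ws)))

  e≈E : ∀ d → e N (+ d) ∼ E d allLetters
  e≈E zero    = ∼-refl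
  e≈E (suc d) = sumWords-∼ (Unique.filter⁺ (decr? N) (words-unique (suc d)))
                           (choose-unique (suc d) allLetters-decreasing)
                           decreasing⇒chosen chosen⇒decreasing
    where
    decreasing⇒chosen : ∀ {w} → w ∈ filter (decr? N) (words N (suc d)) → w ∈ choose (suc d) allLetters
    decreasing⇒chosen w∈ with ∈-filter⁻ (decr? N) {xs = words N (suc d)} w∈
    ... | w∈words , w↓ = ∈-choose⁺ {suc d} (∈-words⁻ w∈words) (Linked⇒AllPairs (flip Fin.<-trans) w↓)
                                   (All.tabulate (λ {x} _ → ∈-allLetters x)) allLetters-decreasing
    chosen⇒decreasing : ∀ {w} → w ∈ choose (suc d) allLetters → w ∈ filter (decr? N) (words N (suc d))
    chosen⇒decreasing {w} w∈ with ∈-choose⁻ {suc d} w∈ allLetters-decreasing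
    ... | |w| , w↓ , _ = ∈-filter⁺ (decr? N) (subst (λ d → w ∈ words N d) |w| (∈-words⁺ w)) (AllPairs⇒Linked w↓)

lemma2p2 : (N : ℕ) (i j : ℤ) → _≡ᴵ_ N (_⊗_ N (e N i) (e N j)) (_⊗_ N (e N j) (e N i))
lemma2p2 N i j = e-commute i j
  where
  open Pairing N
  open Solver
  open IdealClosure N
  open Commutation N
  open Enumeration N

  e-commute : ∀ i j → InIdeal N ⟦ e N i , e N j ⟧
  e-commute -[1+ _ ] j        = ∈-∼0 (solve 1 (λ q → :[ :0 , q ] , :0) (e N j ∷ []))
  e-commute (+ a)    -[1+ _ ] = ∈-∼0 (solve 1 (λ p → :[ p , :0 ] , :0) (e N (+ a) ∷ []))
  e-commute (+ a)    (+ b)    =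
    resp∼ (⟦,⟧-cong (∼-sym (e≈E a)) (∼-sym (e≈E b)))
          (E-commute (suc (length allLetters)) ℕ.≤-refl allLetters-decreasing a b)
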